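{- Let $r\ge 2$ and let $G=K(1,\ldots,1,2)$ be the complete $(r+1)$-partite graph with $r$ parts of size $1$ and one part of size $2$ (equivalently, $K_{r+2}$ with one edge deleted), of order $r+2\ge 4$. Then $G$ is $k$-super graceful if and only if $r=2$ and $k=1$.
   Context: For integers $a\le b$, $[a,b]$ is the set of integers between $a$ and $b$ inclusive. For $k\ge 1$, a $k$-super graceful labeling of a graph $G=(V,E)$ with $p$ vertices and $q$ edges is a bijection $f:V\cup E\to[k,k+p+q-1]$ with $f(uv)=|f(u)-f(v)|$ for every edge $uv$; $G$ is $k$-super graceful if it admits one. -}

module Defs where

open import Data.Nat using (ℕ; suc; _+_; _∸_; _≤_; _<_; _≟_; ∣_-_∣)
open import Data.Fin using (Fin; toℕ; _<?_)
import Data.Fin as F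
open import Data.List using (List; length; filter; allFin; cartesianProduct; lookup)
open import Data.Product using (Σ; _×_; _,_; proj₁; proj₂)
open import Data.Sum using (_⊎_; inj₁; inj₂)
open import Relation.Nullary using (Dec; ¬_; yes; no)
open import Relation.Nullary.Decidable using (_×-dec_; ¬?)
open import Relation.Binary.PropositionalEquality using (_≡_)
open import Function.Definitions using (Bijective)

record Graph : Set₁ where
  field
    p      : ℕ
    Adj    : Fin p → Fin p → Set
    adj?   : ∀ u v → Dec (Adj u v)
    adj-sym    : ∀ {u v} → Adj u v → Adj v u
    adj-irrefl : ∀ {u} → ¬ Adj u u

  edgeList : List (Fin p × Fin p)
  edgeList = filter (λ e → (proj₁ e <? proj₂ e) ×-dec adj? (proj₁ e) (proj₂ e))
                    (cartesianProduct (allFin p) (allFin p))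

  q : ℕ
  q = length edgeList

  Edge : Set
  Edge = Fin q

  ends : Edge → Fin p × Fin p
  ends = lookup edgeList

open Graph public

Interval : ℕ → ℕ → Set
Interval a b = Σ ℕ λ n → a ≤ n × n ≤ b

record SuperGracefulLabeling (k : ℕ) (G : Graph) : Set where
  field
    f        : Fin (p G) ⊎ Edge G → Interval k (k + p G + q G ∸ 1)
    bij      : Bijective _≡_ _≡_ f
    edge-lab : ∀ (e : Edge G) →
               proj₁ (f (inj₂ e)) ≡
               ∣ proj₁ (f (inj₁ (proj₁ (ends G e)))) - proj₁ (f (inj₁ (proj₂ (ends G e)))) ∣

IsKSuperGraceful : ℕ → Graph → Set
IsKSuperGraceful k G = SuperGracefulLabeling k G

open import Relation.Nullary.Decidable using (_⊎-dec_)
open import Relation.Binary.PropositionalEquality using (refl; sym)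

KAdj : (r : ℕ) → Fin (r + 2) → Fin (r + 2) → Set
KAdj r u v = ¬ (u ≡ v) × ¬ ((toℕ u ≡ r × toℕ v ≡ suc r) ⊎ (toℕ u ≡ suc r × toℕ v ≡ r))

KAdj? : (r : ℕ) → ∀ u v → Dec (KAdj r u v)
KAdj? r u v = ¬? (u F.≟ v) ×-dec ¬? (((toℕ u ≟ r) ×-dec (toℕ v ≟ suc r)) ⊎-dec ((toℕ u ≟ suc r) ×-dec (toℕ v ≟ r)))

KAdj-sym : (r : ℕ) → ∀ {u v} → KAdj r u v → KAdj r v u
KAdj-sym r (ne , nm) = (λ e → ne (sym e)) , λ { (inj₁ (a , b)) → nm (inj₂ (b , a)) ; (inj₂ (a , b)) → nm (inj₁ (b , a)) }

KAdj-irrefl : (r : ℕ) → ∀ {u} → ¬ KAdj r u u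
KAdj-irrefl r (ne , _) = ne refl

K1…12 : ℕ → Graph
K1…12 r = record
  { p = r + 2 ; Adj = KAdj r ; adj? = KAdj? r
  ; adj-sym = KAdj-sym r ; adj-irrefl = KAdj-irrefl r }

module Submission where

-- A k-super graceful labeling is, once the graph is forgotten, a difference
-- cover of [k, M] with M = k + p + q ∸ 1: a set of vertex labels with one
-- distinguished pair x₀ < y₀ (the non-adjacent vertices) such that the
-- differences of all other pairs are distinct, at least k, never labels,
-- and together with the labels exhaust [k, M] (DifferenceCovers, Labelings).
-- Counting the top four numbers shows that the least label is at most 3.
-- Every number M ∸ j near the top is a label or the difference of a label
-- close to the least one and a label close to M; this ties the labels at
-- both ends of [k, M] together by constraints that do not involve M.

open import Defs
open import Data.Nat using (ℕ; _≤_; _≥_)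
open import Data.Product using (_×_)
open import Function.Bundles using (_⇔_)
open import Relation.Binary.PropositionalEquality using (_≡_)

module DifferenceCovers where

  open import Data.Bool using (Bool; true; false)
  open import Data.Nat using (ℕ; suc; _+_; _∸_; _≤_; _<_; _≟_; _≤?_; s≤s; z≤n)
  open import Data.Nat.Properties
  open import Data.Product using (Σ; _×_; _,_)
  open import Data.Sum using (_⊎_; inj₁; inj₂)
  open import Data.Empty using (⊥; ⊥-elim)
  open import Relation.Nullary using (¬_; yes; no)
  open import Relation.Binary.PropositionalEquality using (_≡_; refl; sym; trans; subst; subst₂)

  -- x < y are labels but not the non-adjacent pair (x₀, y₀): they span an edge
  record EdgePair (label : ℕ → Bool) (x₀ y₀ x y : ℕ) : Set where
    constructor edgePair
    field
      lower-label : label x ≡ true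
      upper-label : label y ≡ true
      ordered     : x < y
      joined      : ¬ (x ≡ x₀ × y ≡ y₀)

  -- What a k-super graceful labeling of K(1,…,1,2) leaves of itself once the
  -- graph is forgotten: the set of vertex labels inside [k, M], its least
  -- element, and the labels x₀ < y₀ of the two non-adjacent vertices.
  record DifferenceCover (k M : ℕ) : Set where
    field
      label : ℕ → Bool
      least x₀ y₀ : ℕ

    Label : ℕ → Set
    Label z = label z ≡ true

    Joined : ℕ → ℕ → Set
    Joined = EdgePair label x₀ y₀

    field
      least-label : Label least
      least-min   : ∀ {z} → Label z → least ≤ z
      k≤label     : ∀ {z} → Label z → k ≤ z
      label≤M     : ∀ {z} → Label z → z ≤ M
      x₀-label    : Label x₀
      y₀-label    : Label y₀
      x₀<y₀       : x₀ < y₀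
      covers      : ∀ z → k ≤ z → z ≤ M →
                    Label z ⊎ Σ ℕ λ x → Σ ℕ λ y → Joined x y × y ∸ x ≡ z
      gaps-distinct  : ∀ {x y x' y'} → Joined x y → Joined x' y' → y ∸ x ≡ y' ∸ x' → x ≡ x'
      gap-unlabelled : ∀ {x y} → Joined x y → label (y ∸ x) ≡ false
      k≤gap          : ∀ {x y} → Joined x y → k ≤ y ∸ x

  module _ {k M : ℕ} (D : DifferenceCover k M) where
    open DifferenceCover D

    unitEdge : ∀ {x} → Label x → Label (suc x) → ¬ x ≡ x₀ → Joined x (suc x)
    unitEdge lx lsx x≢x₀ = edgePair lx lsx ≤-refl (λ (x≡x₀ , _) → x≢x₀ x≡x₀)

    unitEdges-coincide : ∀ {x x'} → Joined x (suc x) → Joined x' (suc x') → x ≡ x'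
    unitEdges-coincide {x} {x'} e e' =
      gaps-distinct e e' (trans (m+n∸n≡m 1 x) (sym (m+n∸n≡m 1 x')))

    -- Otherwise every gap is smaller than M ∸ 3, so the four largest numbers
    -- are labels; of the three unit steps between them at most one is the
    -- non-adjacent pair, and the other two are distinct edges of length one.
    least≤3 : k + 3 ≤ M → least ≤ 3
    least≤3 k+3≤M with least ≤? 3
    ... | yes least≤3 = least≤3
    ... | no least≰3 = ⊥-elim (TopFour.twoUnitEdges (M ∸ 3) (m+[n∸m]≡n (≤-trans (m≤n+m 3 k) k+3≤M)))
      where
      module TopFour (m : ℕ) (M≡ : 3 + m ≡ M) where
        k≤m : k ≤ m
        k≤m = +-cancelˡ-≤ 3 k m (subst₂ _≤_ (+-comm k 3) (sym M≡) k+3≤M)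

        gap<m : ∀ {x y} → Joined x y → y ∸ x < m
        gap<m {x} {y} e = +-cancelˡ-≤ 3 (suc (y ∸ x)) m (begin
          4 + (y ∸ x) ≤⟨ +-monoˡ-≤ (y ∸ x) (≤-trans (≰⇒> least≰3) (least-min lower-label)) ⟩
          x + (y ∸ x) ≡⟨ m+[n∸m]≡n (<⇒≤ ordered) ⟩
          y           ≤⟨ label≤M upper-label ⟩
          M           ≡⟨ sym M≡ ⟩
          3 + m       ∎)
          where
          open EdgePair e
          open ≤-Reasoning

        -- no gap reaches the numbers m, …, m + 3, so they are labels
        topLabel : ∀ i → i ≤ 3 → Label (i + m)
        topLabel i i≤3 with covers (i + m) (≤-trans k≤m (m≤n+m m i))
                                   (subst (i + m ≤_) M≡ (+-monoˡ-≤ m i≤3))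
        ... | inj₁ labelled = labelled
        ... | inj₂ (x , y , e , gap≡) =
          ⊥-elim (<-irrefl refl (<-≤-trans (gap<m e) (subst (m ≤_) (sym gap≡) (m≤n+m m i))))

        unitStep : ∀ i → i < 3 → ¬ i + m ≡ x₀ → Joined (i + m) (suc i + m)
        unitStep i i<3 i+m≢x₀ =
          unitEdge (topLabel i (<⇒≤ i<3)) (topLabel (suc i) i<3) i+m≢x₀

        -- two different unit steps avoiding x₀ would be distinct edges of length one
        clash : ∀ i j → i < j → j < 3 → ¬ i + m ≡ x₀ → ¬ j + m ≡ x₀ → ⊥
        clash i j i<j j<3 i≢ j≢ =
          <-irrefl (+-cancelʳ-≡ m i j (unitEdges-coincide (unitStep i (<-trans i<j j<3) i≢) (unitStep j j<3 j≢)))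
                   i<j

        avoids : ∀ {i j} → ¬ i ≡ j → x₀ ≡ j + m → ¬ i + m ≡ x₀
        avoids i≢j x₀≡ e = i≢j (+-cancelʳ-≡ m _ _ (trans e x₀≡))

        twoUnitEdges : ⊥
        twoUnitEdges with x₀ ≟ 0 + m | x₀ ≟ 1 + m
        ... | yes x₀≡m | _ = clash 1 2 ≤-refl ≤-refl (avoids (λ ()) x₀≡m) (avoids (λ ()) x₀≡m)
        ... | no x₀≢m | yes x₀≡1+m =
          clash 0 2 (s≤s z≤n) ≤-refl (λ e → x₀≢m (sym e)) (avoids (λ ()) x₀≡1+m)
        ... | no x₀≢m | no x₀≢1+m =
          clash 0 1 ≤-refl (s≤s (s≤s z≤n)) (λ e → x₀≢m (sym e)) (λ e → x₀≢1+m (sym e))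

module Labelings where

  open import Defs
  open DifferenceCovers
  open import Data.Bool using (Bool; true; false)
  open import Data.Nat
  open import Data.Nat.Properties
  open import Data.Fin using (Fin; toℕ; fromℕ<)
  import Data.Fin as F
  import Data.Fin.Properties as FP
  open import Data.List using (allFin; cartesianProduct)
  open import Data.List.Extrema.Nat using (argmin; f[argmin]≤f[xs])
  open import Data.List.Membership.Propositional using (_∈_)
  open import Data.List.Membership.Propositional.Properties
    using (∈-filter⁺; ∈-filter⁻; ∈-cartesianProduct⁺; ∈-allFin; ∈-lookup)
  open import Data.List.Relation.Unary.Any using (index)
  open import Data.List.Relation.Unary.Any.Properties using (lookup-index)
  import Data.List.Relation.Unary.All as All
  open import Data.Product using (Σ; _×_; _,_; proj₁; proj₂)
  open import Data.Sum using (_⊎_; inj₁; inj₂)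
  open import Data.Empty using (⊥; ⊥-elim)
  open import Relation.Nullary using (¬_; Dec; yes; no; does)
  open import Relation.Nullary.Decidable using (_×-dec_)
  open import Relation.Binary.PropositionalEquality
  open import Relation.Binary.Definitions using (tri<; tri≈; tri>)

  module _ (G : Graph) where

    adjacentOrdered? : ∀ (e : Fin (p G) × Fin (p G)) →
                       Dec (proj₁ e F.< proj₂ e × Adj G (proj₁ e) (proj₂ e))
    adjacentOrdered? e = (proj₁ e F.<? proj₂ e) ×-dec adj? G (proj₁ e) (proj₂ e)

    ends-adjacent : ∀ (e : Edge G) →
      proj₁ (ends G e) F.< proj₂ (ends G e) × Adj G (proj₁ (ends G e)) (proj₂ (ends G e))
    ends-adjacent e =
      proj₂ (∈-filter⁻ adjacentOrdered? {xs = cartesianProduct (allFin (p G)) (allFin (p G))} (∈-lookup e))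

    edgeBetween : ∀ u v → u F.< v → Adj G u v → Σ (Edge G) λ e → ends G e ≡ (u , v)
    edgeBetween u v u<v adjacent = index listed , sym (lookup-index listed)
      where
      listed : (u , v) ∈ edgeList G
      listed = ∈-filter⁺ adjacentOrdered? (∈-cartesianProduct⁺ (∈-allFin u) (∈-allFin v)) (u<v , adjacent)

  module Values {k : ℕ} (G : Graph) (L : SuperGracefulLabeling k G) where
    open SuperGracefulLabeling L

    M : ℕ
    M = k + p G + q G ∸ 1

    value : Fin (p G) ⊎ Edge G → ℕ
    value x = proj₁ (f x)

    k≤value : ∀ x → k ≤ value x
    k≤value x = proj₁ (proj₂ (f x))

    value≤M : ∀ x → value x ≤ M
    value≤M x = proj₂ (proj₂ (f x))

    value-injective : ∀ {x y} → value x ≡ value y → x ≡ y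
    value-injective {x} {y} same = proj₁ bij (sameNumber (f x) (f y) same)
      where
      sameNumber : (i j : Interval k M) → proj₁ i ≡ proj₁ j → i ≡ j
      sameNumber (n , k≤n , n≤M) (.n , k≤n' , n≤M') refl
        rewrite ≤-irrelevant k≤n k≤n' | ≤-irrelevant n≤M n≤M' = refl

    value-onto : ∀ z → k ≤ z → z ≤ M → Σ (Fin (p G) ⊎ Edge G) λ x → value x ≡ z
    value-onto z k≤z z≤M = let (x , hit) = proj₂ bij (z , k≤z , z≤M) in x , cong proj₁ (hit refl)

    vertexLabel : Fin (p G) → ℕ
    vertexLabel v = value (inj₁ v)

    edgeLabel : Edge G → ℕ
    edgeLabel e = value (inj₂ e)

    vertexLabel-injective : ∀ {u v} → vertexLabel u ≡ vertexLabel v → u ≡ v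
    vertexLabel-injective same with value-injective same
    ... | refl = refl

    vertex≢edge : ∀ {v e} → vertexLabel v ≢ edgeLabel e
    vertex≢edge same with value-injective same
    ... | ()

    label : ℕ → Bool
    label z = does (FP.any? (λ v → vertexLabel v ≟ z))

    label-witness : ∀ {z} → label z ≡ true → Σ (Fin (p G)) λ v → vertexLabel v ≡ z
    label-witness {z} labelled with FP.any? (λ v → vertexLabel v ≟ z)
    ... | yes found = found

    label-intro : ∀ v {z} → vertexLabel v ≡ z → label z ≡ true
    label-intro v {z} hit with FP.any? (λ v → vertexLabel v ≟ z)
    ... | yes _ = refl
    ... | no none = ⊥-elim (none (v , hit))

  module ToCover (r k : ℕ) (L : SuperGracefulLabeling k (K1…12 r)) where
    open Values (K1…12 r) L
    open SuperGracefulLabeling L using (edge-lab)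

    vertexR vertexR+1 : Fin (r + 2)
    vertexR = fromℕ< (subst (r <_) (+-comm 2 r) (m<n+m r (s≤s z≤n)))
    vertexR+1 = fromℕ< (subst (suc r <_) (+-comm 2 r) (s≤s (m<n+m r (s≤s z≤n))))

    A B : ℕ
    A = vertexLabel vertexR
    B = vertexLabel vertexR+1

    labelledA : ∀ {u} → vertexLabel u ≡ A → toℕ u ≡ r
    labelledA same = trans (cong toℕ (vertexLabel-injective same)) (FP.toℕ-fromℕ< _)

    labelledB : ∀ {u} → vertexLabel u ≡ B → toℕ u ≡ suc r
    labelledB same = trans (cong toℕ (vertexLabel-injective same)) (FP.toℕ-fromℕ< _)

    vertexA : ∀ {u} → toℕ u ≡ r → vertexLabel u ≡ A
    vertexA u≡r = cong vertexLabel (FP.toℕ-injective (trans u≡r (sym (FP.toℕ-fromℕ< _))))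

    vertexB : ∀ {u} → toℕ u ≡ suc r → vertexLabel u ≡ B
    vertexB u≡r+1 = cong vertexLabel (FP.toℕ-injective (trans u≡r+1 (sym (FP.toℕ-fromℕ< _))))

    x₀ y₀ : ℕ
    x₀ = A ⊓ B
    y₀ = A ⊔ B

    ordered-pair : ∀ {x y} → x < y → (x ≡ A × y ≡ B) ⊎ (x ≡ B × y ≡ A) → x ≡ x₀ × y ≡ y₀
    ordered-pair x<y (inj₁ (refl , refl)) = sym (m≤n⇒m⊓n≡m (<⇒≤ x<y)) , sym (m≤n⇒m⊔n≡n (<⇒≤ x<y))
    ordered-pair x<y (inj₂ (refl , refl)) = sym (m≥n⇒m⊓n≡n (<⇒≤ x<y)) , sym (m≥n⇒m⊔n≡m (<⇒≤ x<y))

    x₀<y₀ : x₀ < y₀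
    x₀<y₀ with <-cmp A B
    ... | tri< A<B _ _ = let (ex , ey) = ordered-pair A<B (inj₁ (refl , refl)) in subst₂ _<_ ex ey A<B
    ... | tri≈ _ A≡B _ = ⊥-elim (1+n≢n (sym (trans (sym (labelledA refl)) (labelledB A≡B))))
    ... | tri> _ _ B<A = let (ex , ey) = ordered-pair B<A (inj₂ (refl , refl)) in subst₂ _<_ ex ey B<A

    labelAorB : ∀ {z} → z ≡ A ⊎ z ≡ B → label z ≡ true
    labelAorB (inj₁ z≡A) = label-intro vertexR (sym z≡A)
    labelAorB (inj₂ z≡B) = label-intro vertexR+1 (sym z≡B)

    nonAdjacent : ∀ {u v} → KAdj r u v → vertexLabel u ≡ x₀ → vertexLabel v ≡ y₀ → ⊥
    nonAdjacent (u≢v , notRR) eu ev with ⊓-sel A B | ⊔-sel A B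
    ... | inj₁ x₀≡A | inj₁ y₀≡A =
      u≢v (vertexLabel-injective (trans (trans eu x₀≡A) (sym (trans ev y₀≡A))))
    ... | inj₁ x₀≡A | inj₂ y₀≡B = notRR (inj₁ (labelledA (trans eu x₀≡A) , labelledB (trans ev y₀≡B)))
    ... | inj₂ x₀≡B | inj₁ y₀≡A = notRR (inj₂ (labelledB (trans eu x₀≡B) , labelledA (trans ev y₀≡A)))
    ... | inj₂ x₀≡B | inj₂ y₀≡B =
      u≢v (vertexLabel-injective (trans (trans eu x₀≡B) (sym (trans ev y₀≡B))))

    adjacentUnless : ∀ {u v} → vertexLabel u < vertexLabel v → ¬ (vertexLabel u ≡ x₀ × vertexLabel v ≡ y₀) →
                     KAdj r u v
    adjacentUnless {u} {v} lt notPair = (λ { refl → <-irrefl refl lt }) , notRR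
      where
      notRR : ¬ ((toℕ u ≡ r × toℕ v ≡ suc r) ⊎ (toℕ u ≡ suc r × toℕ v ≡ r))
      notRR (inj₁ (ur , vr)) = notPair (ordered-pair lt (inj₁ (vertexA ur , vertexB vr)))
      notRR (inj₂ (ur , vr)) = notPair (ordered-pair lt (inj₂ (vertexB ur , vertexA vr)))

    Joined : ℕ → ℕ → Set
    Joined = EdgePair label x₀ y₀

    edgePairOf : ∀ {u v} → KAdj r u v → vertexLabel u < vertexLabel v → Joined (vertexLabel u) (vertexLabel v)
    edgePairOf adjacent lt =
      edgePair (label-intro _ refl) (label-intro _ refl) lt (λ (eu , ev) → nonAdjacent adjacent eu ev)

    lowerEnd : Edge (K1…12 r) → ℕ
    lowerEnd e = vertexLabel (proj₁ (ends (K1…12 r) e)) ⊓ vertexLabel (proj₂ (ends (K1…12 r) e))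

    edgeJoining : ∀ {u v} → KAdj r u v →
      Σ (Edge (K1…12 r)) λ e → edgeLabel e ≡ ∣ vertexLabel u - vertexLabel v ∣
                             × lowerEnd e ≡ vertexLabel u ⊓ vertexLabel v
    edgeJoining {u} {v} adjacent with FP.<-cmp u v
    ... | tri< u<v _ _ with edgeBetween (K1…12 r) u v u<v adjacent
    ...   | e , refl = e , edge-lab e , refl
    edgeJoining {u} {v} adjacent | tri≈ _ u≡v _ = ⊥-elim (proj₁ adjacent u≡v)
    edgeJoining {u} {v} adjacent | tri> _ _ v<u with edgeBetween (K1…12 r) v u v<u (KAdj-sym r adjacent)
    ...   | e , refl = e , trans (edge-lab e) (∣-∣-comm (vertexLabel v) (vertexLabel u))
                         , ⊓-comm (vertexLabel v) (vertexLabel u)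

    realise : ∀ {x y} → Joined x y → Σ (Edge (K1…12 r)) λ e → edgeLabel e ≡ y ∸ x × lowerEnd e ≡ x
    realise {x} {y} e₀ with label-witness (EdgePair.lower-label e₀) | label-witness (EdgePair.upper-label e₀)
    ... | u , refl | v , refl =
      let (e , labelled , lower) = edgeJoining (adjacentUnless ordered joined)
      in e , trans labelled (m≤n⇒∣m-n∣≡n∸m (<⇒≤ ordered)) , trans lower (m≤n⇒m⊓n≡m (<⇒≤ ordered))
      where open EdgePair e₀

    edgePairJoining : ∀ {u v} → KAdj r u v →
      Σ ℕ λ x → Σ ℕ λ y → Joined x y × y ∸ x ≡ ∣ vertexLabel u - vertexLabel v ∣
    edgePairJoining {u} {v} adjacent with <-cmp (vertexLabel u) (vertexLabel v)
    ... | tri< lt _ _ = _ , _ , edgePairOf adjacent lt , sym (m≤n⇒∣m-n∣≡n∸m (<⇒≤ lt))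
    ... | tri≈ _ eq _ = ⊥-elim (proj₁ adjacent (vertexLabel-injective eq))
    ... | tri> _ _ gt = _ , _ , edgePairOf (KAdj-sym r adjacent) gt ,
                        trans (sym (m≤n⇒∣m-n∣≡n∸m (<⇒≤ gt))) (∣-∣-comm (vertexLabel v) (vertexLabel u))

    leastVertex : Fin (r + 2)
    leastVertex = argmin vertexLabel vertexR (allFin (r + 2))

    cover : DifferenceCover k M
    cover = record
      { label = label
      ; least = vertexLabel leastVertex
      ; x₀ = x₀
      ; y₀ = y₀
      ; least-label = label-intro leastVertex refl
      ; least-min = λ labelled → let (v , hit) = label-witness labelled in
          subst (_ ≤_) hit (All.lookup (f[argmin]≤f[xs] {f = vertexLabel} vertexR (allFin (r + 2))) (∈-allFin v))
      ; k≤label = λ labelled → let (v , hit) = label-witness labelled in subst (k ≤_) hit (k≤value (inj₁ v))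
      ; label≤M = λ labelled → let (v , hit) = label-witness labelled in subst (_≤ M) hit (value≤M (inj₁ v))
      ; x₀-label = labelAorB (⊓-sel A B)
      ; y₀-label = labelAorB (⊔-sel A B)
      ; x₀<y₀ = x₀<y₀
      ; covers = covers
      ; gaps-distinct = λ e e' same →
          let (d , labelled , lower) = realise e
              (d' , labelled' , lower') = realise e'
          in trans (sym lower) (trans (cong lowerEnd (inj₂-injective (value-injective
               (trans labelled (trans same (sym labelled')))))) lower')
      ; gap-unlabelled = gap-unlabelled
      ; k≤gap = λ e → let (d , labelled , _) = realise e in subst (k ≤_) labelled (k≤value (inj₂ d))
      }
      where
      inj₂-injective : ∀ {d d'} → inj₂ {A = Fin (r + 2)} d ≡ inj₂ d' → d ≡ d'
      inj₂-injective refl = refl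

      covers : ∀ z → k ≤ z → z ≤ M → label z ≡ true ⊎ Σ ℕ λ x → Σ ℕ λ y → Joined x y × y ∸ x ≡ z
      covers z k≤z z≤M with value-onto z k≤z z≤M
      ... | inj₁ v , hit = inj₁ (label-intro v hit)
      ... | inj₂ d , hit =
        let (x , y , e , gap) = edgePairJoining (proj₂ (ends-adjacent (K1…12 r) d))
        in inj₂ (x , y , e , trans gap (trans (sym (edge-lab d)) hit))

      gap-unlabelled : ∀ {x y} → Joined x y → label (y ∸ x) ≡ false
      gap-unlabelled {x} {y} e with label (y ∸ x) in labelled
      ... | false = refl
      ... | true = let (v , hit) = label-witness labelled
                       (d , edgeLabelled , _) = realise e
                   in ⊥-elim (vertex≢edge (trans hit (sym edgeLabelled)))

-- For r ≥ 4 the graph K(1,…,1,2) has at least ten edges: the vertices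
-- 0, …, 4 are pairwise adjacent, since only the pair {r, r + 1} is not.
module EdgeCount where

  open import Defs
  open Labelings using (edgeBetween)
  open import Data.Nat using (ℕ; suc; _+_; _≤_; _<_; s≤s)
  open import Data.Nat.Properties using (≤-trans; <-irrefl; n≤1+n; +-monoˡ-≤)
  open import Data.Fin using (Fin; toℕ; #_; inject≤)
  import Data.Fin as F
  import Data.Fin.Properties as FP
  open import Data.Vec using (Vec; []; _∷_; lookup)
  open import Data.Product using (Σ; _×_; _,_; proj₁; proj₂)
  open import Data.Product.Properties using (≡-dec)
  open import Data.Sum using (_⊎_; inj₁; inj₂)
  open import Relation.Nullary using (¬_)
  open import Relation.Nullary.Decidable using (from-yes; _→-dec_)
  open import Relation.Binary.PropositionalEquality

  smallPairs : Vec (Fin 5 × Fin 5) 10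
  smallPairs = (# 0 , # 1) ∷ (# 0 , # 2) ∷ (# 0 , # 3) ∷ (# 0 , # 4) ∷ (# 1 , # 2)
             ∷ (# 1 , # 3) ∷ (# 1 , # 4) ∷ (# 2 , # 3) ∷ (# 2 , # 4) ∷ (# 3 , # 4) ∷ []

  smallPair : Fin 10 → Fin 5 × Fin 5
  smallPair = lookup smallPairs

  smallPair-ordered : ∀ c → proj₁ (smallPair c) F.< proj₂ (smallPair c)
  smallPair-ordered = from-yes (FP.all? λ c → proj₁ (smallPair c) F.<? proj₂ (smallPair c))

  smallPair-injective : ∀ c c' → smallPair c ≡ smallPair c' → c ≡ c'
  smallPair-injective = from-yes (FP.all? λ c → FP.all? λ c' →
    ≡-dec F._≟_ F._≟_ (smallPair c) (smallPair c') →-dec c F.≟ c')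

  module _ (r : ℕ) (4≤r : 4 ≤ r) where

    vertex : Fin 5 → Fin (r + 2)
    vertex i = inject≤ i (≤-trans (n≤1+n 5) (+-monoˡ-≤ 2 4≤r))

    toℕ-vertex : ∀ i → toℕ (vertex i) ≡ toℕ i
    toℕ-vertex i = FP.toℕ-inject≤ i _

    vertex-injective : ∀ {i j} → vertex i ≡ vertex j → i ≡ j
    vertex-injective = FP.inject≤-injective _ _ _ _

    -- vertices below 5 are never r + 1, so no small pair is {r, r + 1}
    small-adjacent : ∀ i j → i F.< j → KAdj r (vertex i) (vertex j)
    small-adjacent i j i<j = different , notRR
      where
      below5 : ∀ i → toℕ (vertex i) < suc r
      below5 i = subst (_< suc r) (sym (toℕ-vertex i)) (≤-trans (FP.toℕ<n i) (s≤s 4≤r))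
      different : ¬ vertex i ≡ vertex j
      different same = <-irrefl (cong toℕ (vertex-injective same)) i<j
      notRR : ¬ ((toℕ (vertex i) ≡ r × toℕ (vertex j) ≡ suc r)
               ⊎ (toℕ (vertex i) ≡ suc r × toℕ (vertex j) ≡ r))
      notRR (inj₁ (_ , j≡r+1)) = <-irrefl j≡r+1 (below5 j)
      notRR (inj₂ (i≡r+1 , _)) = <-irrefl i≡r+1 (below5 i)

    smallEdge : ∀ c → Σ (Edge (K1…12 r)) λ e →
      ends (K1…12 r) e ≡ (vertex (proj₁ (smallPair c)) , vertex (proj₂ (smallPair c)))
    smallEdge c = edgeBetween (K1…12 r) (vertex i) (vertex j)
      (subst₂ _<_ (sym (toℕ-vertex i)) (sym (toℕ-vertex j)) i<j) (small-adjacent i j i<j)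
      where
      i j : Fin 5
      i = proj₁ (smallPair c)
      j = proj₂ (smallPair c)
      i<j : i F.< j
      i<j = smallPair-ordered c

    smallEdge-injective : ∀ {c c'} → proj₁ (smallEdge c) ≡ proj₁ (smallEdge c') → c ≡ c'
    smallEdge-injective {c} {c'} same = smallPair-injective c c' (cong₂ _,_
      (vertex-injective (cong proj₁ sameEnds)) (vertex-injective (cong proj₂ sameEnds)))
      where
      sameEnds : (vertex (proj₁ (smallPair c)) , vertex (proj₂ (smallPair c)))
               ≡ (vertex (proj₁ (smallPair c')) , vertex (proj₂ (smallPair c')))
      sameEnds = trans (sym (proj₂ (smallEdge c))) (trans (cong (ends (K1…12 r)) same) (proj₂ (smallEdge c')))

    ten≤edges : 10 ≤ q (K1…12 r)
    ten≤edges = FP.injective⇒≤ smallEdge-injective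

module BooleanChecks where

  open import Data.Bool using (Bool; true; false; _∧_; _∨_; not; T)
  open import Data.Bool.Properties using (not-involutive; T-≡)
  open import Data.Nat using (ℕ; zero; suc; _≤_; _<_; _≤ᵇ_; s≤s; _<?_)
  open import Data.Nat.Properties
    using (≤-refl; m≤n⇒m≤1+n; m≤n⇒m<n∨m≡n; ≤-pred; <-irrefl; ≤ᵇ⇒≤; ≤⇒≤ᵇ; ≮⇒≥)
  open import Data.List using (List; []; _∷_; _++_; length)
  open import Data.Product using (_×_; _,_)
  open import Data.Sum using (_⊎_; inj₁; inj₂)
  open import Data.Empty using (⊥-elim)
  open import Function.Bundles using (Equivalence)
  open import Relation.Nullary using (¬_; yes; no)
  open import Relation.Binary.PropositionalEquality using (_≡_; refl; cong; sym; trans)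

  false≢true : ¬ false ≡ true
  false≢true ()

  ∧-intro : ∀ {x y} → x ≡ true → y ≡ true → x ∧ y ≡ true
  ∧-intro refl refl = refl

  ∧-elim : ∀ x {y} → x ∧ y ≡ true → x ≡ true × y ≡ true
  ∧-elim true holds = refl , holds

  ∨-elim : ∀ x {y} → x ∨ y ≡ true → x ≡ true ⊎ y ≡ true
  ∨-elim true _ = inj₁ refl
  ∨-elim false holds = inj₂ holds

  not-true : ∀ {x} → not x ≡ true → x ≡ false
  not-true {x} holds = trans (sym (not-involutive x)) (cong not holds)

  T⇒true : ∀ {x} → T x → x ≡ true
  T⇒true = Equivalence.to T-≡

  true⇒T : ∀ {x} → x ≡ true → T x
  true⇒T = Equivalence.from T-≡

  ≤ᵇ-true : ∀ {m n} → m ≤ n → (m ≤ᵇ n) ≡ true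
  ≤ᵇ-true m≤n = T⇒true (≤⇒≤ᵇ m≤n)

  ≤ᵇ-sound : ∀ {m n} → (m ≤ᵇ n) ≡ true → m ≤ n
  ≤ᵇ-sound {m} {n} holds = ≤ᵇ⇒≤ m n (true⇒T holds)

  ≤ᵇ-false : ∀ {m n} → ¬ m ≤ n → (m ≤ᵇ n) ≡ false
  ≤ᵇ-false {m} {n} m≰n with m ≤ᵇ n in holds
  ... | false = refl
  ... | true = ⊥-elim (m≰n (≤ᵇ-sound holds))

  -- position i of a bit list; positions beyond the end read as false
  bit : List Bool → ℕ → Bool
  bit [] _ = false
  bit (x ∷ xs) zero = x
  bit (x ∷ xs) (suc i) = bit xs i

  noneBelow : (ℕ → Bool) → ℕ → Bool
  noneBelow f zero = true
  noneBelow f (suc n) = not (f n) ∧ noneBelow f n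

  atMostOneBelow : (ℕ → Bool) → ℕ → Bool
  atMostOneBelow f zero = true
  atMostOneBelow f (suc n) with f n
  ... | true = noneBelow f n
  ... | false = atMostOneBelow f n

  exactlyOneBelow : (ℕ → Bool) → ℕ → Bool
  exactlyOneBelow f zero = false
  exactlyOneBelow f (suc n) with f n
  ... | true = noneBelow f n
  ... | false = exactlyOneBelow f n

  allBelow : (ℕ → Bool) → ℕ → Bool
  allBelow f zero = true
  allBelow f (suc n) = f n ∧ allBelow f n

  noneBelow-intro : ∀ f n → (∀ t → t < n → f t ≡ false) → noneBelow f n ≡ true
  noneBelow-intro f zero none = refl
  noneBelow-intro f (suc n) none rewrite none n ≤-refl =
    noneBelow-intro f n (λ t t<n → none t (m≤n⇒m≤1+n t<n))

  onlyAtTop : ∀ f n → f n ≡ true →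
              (∀ t t' → t < suc n → t' < suc n → f t ≡ true → f t' ≡ true → t ≡ t') →
              noneBelow f n ≡ true
  onlyAtTop f n fn unique = noneBelow-intro f n falseBelow
    where
    falseBelow : ∀ t → t < n → f t ≡ false
    falseBelow t t<n with f t in ft
    ... | false = refl
    ... | true = ⊥-elim (<-irrefl (unique t n (m≤n⇒m≤1+n t<n) ≤-refl ft fn) t<n)

  atMostOneBelow-intro : ∀ f n →
    (∀ t t' → t < n → t' < n → f t ≡ true → f t' ≡ true → t ≡ t') → atMostOneBelow f n ≡ true
  atMostOneBelow-intro f zero unique = refl
  atMostOneBelow-intro f (suc n) unique with f n in fn
  ... | true = onlyAtTop f n fn unique
  ... | false = atMostOneBelow-intro f n
                  (λ t t' p p' → unique t t' (m≤n⇒m≤1+n p) (m≤n⇒m≤1+n p'))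

  exactlyOneBelow-intro : ∀ f n t → t < n → f t ≡ true →
    (∀ t t' → t < n → t' < n → f t ≡ true → f t' ≡ true → t ≡ t') → exactlyOneBelow f n ≡ true
  exactlyOneBelow-intro f (suc n) t t<n ft unique with f n in fn | m≤n⇒m<n∨m≡n (≤-pred t<n)
  ... | true | _ = onlyAtTop f n fn unique
  ... | false | inj₁ t<n' = exactlyOneBelow-intro f n t t<n' ft
                             (λ s s' p p' → unique s s' (m≤n⇒m≤1+n p) (m≤n⇒m≤1+n p'))
  ... | false | inj₂ refl with () ← trans (sym fn) ft

  allBelow-intro : ∀ f n → (∀ i → i < n → f i ≡ true) → allBelow f n ≡ true
  allBelow-intro f zero all = refl
  allBelow-intro f (suc n) all rewrite all n ≤-refl =
    allBelow-intro f n (λ i i<n → all i (m≤n⇒m≤1+n i<n))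

  bit-snoc-< : ∀ (xs : List Bool) x i → i < length xs → bit (xs ++ x ∷ []) i ≡ bit xs i
  bit-snoc-< (y ∷ ys) x zero _ = refl
  bit-snoc-< (y ∷ ys) x (suc i) (s≤s i<n) = bit-snoc-< ys x i i<n

  bit-snoc-last : ∀ (xs : List Bool) x → bit (xs ++ x ∷ []) (length xs) ≡ x
  bit-snoc-last [] x = refl
  bit-snoc-last (y ∷ ys) x = bit-snoc-last ys x

  bit-beyond : ∀ (xs : List Bool) i → length xs ≤ i → bit xs i ≡ false
  bit-beyond [] i _ = refl
  bit-beyond (y ∷ ys) (suc i) (s≤s n≤i) = bit-beyond ys i n≤i

  bit-in-range : ∀ (xs : List Bool) i → bit xs i ≡ true → i < length xs
  bit-in-range xs i set with i <? length xs
  ... | yes i< = i<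
  ... | no i≮ = ⊥-elim (false≢true (trans (sym (bit-beyond xs i (≮⇒≥ i≮))) set))

-- Fix the least label a and a depth J.  The low window consists of the
-- numbers a + i (i ≤ W, where W = J ∸ a), the high window of the numbers
-- M ∸ t (t ≤ J); a configuration records which of them are labels, as two
-- bit lists.  Level j of the search guesses whether M ∸ j is a label (and,
-- once a ≤ j, whether a + (j ∸ a) is one) and checks that M ∸ j is accounted
-- for exactly once.  No check mentions M itself, so a single run of the
-- search deals with every M at once.
module WindowSearch where

  open BooleanChecks
  open import Data.Bool using (Bool; true; false; _∧_; _∨_; not; if_then_else_; _xor_)
  open import Data.Nat using (ℕ; zero; suc; _+_; _∸_; _≤_; _<_; _≡ᵇ_; _<ᵇ_; _≤ᵇ_; _≤?_)
  open import Data.Nat.Properties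
    using (m≤n⇒m<n∨m≡n; ≤-pred; m≤n+m; +-suc; +-identityʳ; +-comm; ≡ᵇ⇒≡; ≡⇒≡ᵇ; +-∸-assoc; m≤n⇒m∸n≡0;
           0∸n≡0; <⇒≤; ≰⇒>)
  open import Data.List.Properties using (length-++)
  open import Data.Bool.Properties using (∨-zeroʳ)
  open import Data.List using (List; []; _∷_; _++_; map; concatMap; length; downFrom)
  open import Data.List.Membership.Propositional using (_∈_)
  open import Data.List.Membership.Propositional.Properties using (∈-map⁺; ∈-concatMap⁺; ∈-downFrom⁺)
  import Data.List.Relation.Unary.Any as Any
  open import Data.List.Relation.Unary.Any using (here; there)
  open import Data.Sum using (inj₁; inj₂)
  open import Data.Product using (_×_; _,_)
  open import Relation.Nullary using (¬_; yes; no)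
  open import Relation.Binary.PropositionalEquality

  -- Where the one non-adjacent pair of labels sits relative to the windows:
  -- a low and a high label (a + b, M ∸ t), two low labels (a + u, a + v),
  -- two high labels (M ∸ u, M ∸ v), or no position the search has to know.
  data PairPosition : Set where
    unseen   : PairPosition
    lowHigh  : ℕ → ℕ → PairPosition
    lowLow   : ℕ → ℕ → PairPosition
    highHigh : ℕ → ℕ → PairPosition

  isLowHigh isLowLow isHighHigh : PairPosition → ℕ → ℕ → Bool
  isLowHigh (lowHigh b t) b' t' = (b ≡ᵇ b') ∧ (t ≡ᵇ t')
  isLowHigh _ _ _ = false
  isLowLow (lowLow u v) u' v' = (u ≡ᵇ u') ∧ (v ≡ᵇ v')
  isLowLow _ _ _ = false
  isHighHigh (highHigh u v) u' v' = (u ≡ᵇ u') ∧ (v ≡ᵇ v')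
  isHighHigh _ _ _ = false

  matches : ∀ m n m' n' → (m ≡ᵇ m') ∧ (n ≡ᵇ n') ≡ true → m ≡ m' × n ≡ n'
  matches m n m' n' same with ∧-elim (m ≡ᵇ m') same
  ... | m≡m' , n≡n' = ≡ᵇ⇒≡ m m' (true⇒T m≡m') , ≡ᵇ⇒≡ n n' (true⇒T n≡n')

  matches-refl : ∀ m n → (m ≡ᵇ m) ∧ (n ≡ᵇ n) ≡ true
  matches-refl m n = ∧-intro (T⇒true (≡⇒≡ᵇ m m refl)) (T⇒true (≡⇒≡ᵇ n n refl))

  lowHighPositions : ℕ → ℕ → List PairPosition
  lowHighPositions W J = concatMap (λ b → map (lowHigh b) (downFrom (suc J))) (downFrom (suc W))

  lowLowPositions : ℕ → List PairPosition
  lowLowPositions W = concatMap (λ u → map (lowLow u) (downFrom (suc W))) (downFrom (suc W))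

  highHighPositions : ℕ → List PairPosition
  highHighPositions J = concatMap (λ u → map (highHigh u) (downFrom (suc J))) (downFrom (suc J))

  positions : ℕ → ℕ → List PairPosition
  positions W J = unseen ∷ lowHighPositions W J ++ lowLowPositions W ++ highHighPositions J

  ∈-grid : ∀ {A : Set} (f : ℕ → ℕ → A) {m n i j} → i < m → j < n →
           f i j ∈ concatMap (λ i → map (f i) (downFrom n)) (downFrom m)
  ∈-grid f i<m j<n =
    ∈-concatMap⁺ _ (Any.map (λ { refl → ∈-map⁺ (f _) (∈-downFrom⁺ j<n) }) (∈-downFrom⁺ i<m))

  module Search (a k J L : ℕ) (checkGaps checkOverlap : Bool) (P : PairPosition) where

    W : ℕ
    W = J ∸ a

    -- option t accounts for the value M ∸ j: for t + a ≤ j as the difference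
    -- of the labels a + (j ∸ a ∸ t) and M ∸ t, for t = j as a label itself
    accounts : List Bool → List Bool → ℕ → ℕ → Bool
    accounts low high j t =
      if t + a ≤ᵇ j
      then bit low (j ∸ a ∸ t) ∧ bit high t ∧ not (isLowHigh P (j ∸ a ∸ t) t)
      else (t ≡ᵇ j) ∧ bit high j

    highValueOK : List Bool → List Bool → ℕ → Bool
    highValueOK low high j = exactlyOneBelow (accounts low high j) (suc j)

    -- when L = M ∸ a the windows overlap: a + i is the number M ∸ (L ∸ i)
    overlapOK : List Bool → List Bool → Bool
    overlapOK low high = allBelow (λ i →
      if L ∸ i <ᵇ length high then not (bit low i xor bit high (L ∸ i)) else true) (length low)

    -- pair number i at distance d inside one window: positions i ≤ W are pairs
    -- of low labels (a + i, a + i + d), the others pairs of high labels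
    gapPair : List Bool → List Bool → ℕ → ℕ → Bool
    gapPair low high d i =
      if i ≤ᵇ W
      then bit low i ∧ bit low (i + d) ∧ not (isLowLow P i (i + d))
      else bit high (i ∸ suc W) ∧ bit high (i ∸ suc W + d)
           ∧ not (isHighHigh P (i ∸ suc W) (i ∸ suc W + d))

    pairCount : ℕ
    pairCount = suc W + suc J

    -- a difference d is no edge label if d < k or d is a (low) label
    forbiddenGap : List Bool → ℕ → Bool
    forbiddenGap low d = (d <ᵇ k) ∨ ((a ≤ᵇ d) ∧ bit low (d ∸ a))

    gapOK : List Bool → List Bool → ℕ → Bool
    gapOK low high d = atMostOneBelow (gapPair low high d) pairCount
      ∧ (not (forbiddenGap low d) ∨ noneBelow (gapPair low high d) pairCount)

    gapsOK : List Bool → List Bool → Bool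
    gapsOK low high = allBelow (λ d → gapOK low high (suc d)) J

    levelOK : ℕ → List Bool → List Bool → Bool
    levelOK j low high = highValueOK low high j ∧ (if checkOverlap then overlapOK low high else true)

    finalOK : List Bool → List Bool → Bool
    finalOK low high = bit low 0 ∧ (if checkGaps then gapsOK low high else true)

    -- search n j low high: levels j, …, j + n ∸ 1 remain to be decided
    mutual
      search : ℕ → ℕ → List Bool → List Bool → Bool
      search zero j low high = finalOK low high
      search (suc n) j low high =
        guessLow n j low (high ++ true ∷ []) ∨ guessLow n j low (high ++ false ∷ [])

      guessLow : ℕ → ℕ → List Bool → List Bool → Bool
      guessLow n j low high =
        if a ≤ᵇ j
        then descend n j (low ++ true ∷ []) high ∨ descend n j (low ++ false ∷ []) high
        else descend n j low high

      descend : ℕ → ℕ → List Bool → List Bool → Bool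
      descend n j low high = levelOK j low high ∧ search n (suc j) low high

    searchAll : Bool
    searchAll = search (suc J) 0 [] []

  failsAt : (a k J L : ℕ) (checkGaps checkOverlap : Bool) → List PairPosition → Bool
  failsAt a k J L checkGaps checkOverlap [] = true
  failsAt a k J L checkGaps checkOverlap (P ∷ Ps) =
    not (Search.searchAll a k J L checkGaps checkOverlap P) ∧ failsAt a k J L checkGaps checkOverlap Ps

  refutes : (a k J L : ℕ) (checkGaps checkOverlap : Bool) → Bool
  refutes a k J L checkGaps checkOverlap = failsAt a k J L checkGaps checkOverlap (positions (J ∸ a) J)

  failsAt-elim : ∀ a k J L checkGaps checkOverlap {P Ps} → failsAt a k J L checkGaps checkOverlap Ps ≡ true →
                 P ∈ Ps → Search.searchAll a k J L checkGaps checkOverlap P ≡ false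
  failsAt-elim a k J L checkGaps checkOverlap {Ps = Q ∷ Ps} fails P∈
    with ∧-elim (not (Search.searchAll a k J L checkGaps checkOverlap Q)) fails | P∈
  ... | failsAtQ , _ | here refl = not-true failsAtQ
  ... | _ , failsAtPs | there P∈Ps = failsAt-elim a k J L checkGaps checkOverlap failsAtPs P∈Ps

  -- Bit lists guessed along the branch that follows a given truth:
  -- lowTruth i for the low bit i, highTruth t for the high bit t.
  module Faithfulness (a : ℕ) (lowTruth highTruth : ℕ → Bool) where

    Agrees : List Bool → (ℕ → Bool) → Set
    Agrees xs F = ∀ i → i < length xs → bit xs i ≡ F i

    -- the bit lists guessed after deciding levels 0, …, j ∸ 1 as the truth does
    record Faithful (j : ℕ) (low high : List Bool) : Set where
      field
        high-length : length high ≡ j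
        low-length  : length low ≡ j ∸ a
        low-agrees  : Agrees low lowTruth
        high-agrees : Agrees high highTruth

    length-snoc : ∀ (xs : List Bool) x → length (xs ++ x ∷ []) ≡ suc (length xs)
    length-snoc xs x = trans (length-++ xs) (+-comm (length xs) 1)

    agrees-snoc : ∀ xs F → Agrees xs F → Agrees (xs ++ F (length xs) ∷ []) F
    agrees-snoc xs F agree i i<
      with m≤n⇒m<n∨m≡n (≤-pred (subst (i <_) (length-snoc xs _) i<))
    ... | inj₁ i<n = trans (bit-snoc-< xs _ i i<n) (agree i i<n)
    ... | inj₂ refl = bit-snoc-last xs _

    faithful-both : ∀ j low high → Faithful j low high → a ≤ j →
      Faithful (suc j) (low ++ lowTruth (j ∸ a) ∷ []) (high ++ highTruth j ∷ [])
    faithful-both j low high F a≤j = record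
      { high-length = trans (length-snoc high _) (cong suc high-length)
      ; low-length  = trans (length-snoc low _) (trans (cong suc low-length) (sym (+-∸-assoc 1 a≤j)))
      ; low-agrees  = subst (λ n → Agrees (low ++ lowTruth n ∷ []) lowTruth) low-length
                            (agrees-snoc low lowTruth low-agrees)
      ; high-agrees = subst (λ n → Agrees (high ++ highTruth n ∷ []) highTruth) high-length
                            (agrees-snoc high highTruth high-agrees) }
      where open Faithful F

    faithful-high : ∀ j low high → Faithful j low high → ¬ (a ≤ j) →
      Faithful (suc j) low (high ++ highTruth j ∷ [])
    faithful-high j low high F a≰j = record
      { high-length = trans (length-snoc high _) (cong suc high-length)
      ; low-length  = trans low-length (trans (m≤n⇒m∸n≡0 (<⇒≤ j<a)) (sym (m≤n⇒m∸n≡0 j<a)))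
      ; low-agrees  = low-agrees
      ; high-agrees = subst (λ n → Agrees (high ++ highTruth n ∷ []) highTruth) high-length
                            (agrees-snoc high highTruth high-agrees) }
      where
      open Faithful F
      j<a : j < a
      j<a = ≰⇒> a≰j

    faithful-start : Faithful 0 [] []
    faithful-start = record
      { high-length = refl ; low-length = sym (0∸n≡0 a) ; low-agrees = λ _ () ; high-agrees = λ _ () }

  module Completeness (a k J L : ℕ) (checkGaps checkOverlap : Bool) (P : PairPosition)
                      (lowTruth highTruth : ℕ → Bool) where
    open Search a k J L checkGaps checkOverlap P
    open Faithfulness a lowTruth highTruth

    eitherGuess : ∀ (branch : Bool → Bool) b → branch b ≡ true → branch true ∨ branch false ≡ true
    eitherGuess branch true ok rewrite ok = refl
    eitherGuess branch false ok rewrite ok = ∨-zeroʳ _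

    module _ (levels : ∀ j low high → j ≤ J → Faithful (suc j) low high → levelOK j low high ≡ true)
             (final : ∀ low high → Faithful (suc J) low high → finalOK low high ≡ true) where

      search-complete : ∀ n j low high → n + j ≡ suc J → Faithful j low high → search n j low high ≡ true
      guessLow-complete : ∀ n j low high → n + suc j ≡ suc J → Faithful j low high →
                          guessLow n j low (high ++ highTruth j ∷ []) ≡ true
      descend-complete : ∀ n j low high → n + suc j ≡ suc J → Faithful (suc j) low high →
                         descend n j low high ≡ true

      search-complete zero j low high refl F = final low high F
      search-complete (suc n) j low high n+j F =
        eitherGuess (λ b → guessLow n j low (high ++ b ∷ [])) (highTruth j)
                    (guessLow-complete n j low high (trans (+-suc n j) n+j) F)

      guessLow-complete n j low high n+j F with a ≤? j
      ... | yes a≤j rewrite ≤ᵇ-true a≤j =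
        eitherGuess (λ b → descend n j (low ++ b ∷ []) (high ++ highTruth j ∷ [])) (lowTruth (j ∸ a))
                    (descend-complete n j _ _ n+j (faithful-both j low high F a≤j))
      ... | no a≰j rewrite ≤ᵇ-false a≰j = descend-complete n j _ _ n+j (faithful-high j low high F a≰j)

      descend-complete n j low high n+j F
        rewrite levels j low high (≤-pred (subst (suc j ≤_) n+j (m≤n+m (suc j) n))) F =
        search-complete n (suc j) low high n+j F

      searchAll-complete : searchAll ≡ true
      searchAll-complete = search-complete (suc J) 0 [] [] (+-identityʳ (suc J)) faithful-start

module WindowArithmetic where

  open import Data.Nat using (_+_; _∸_; _≤_; _<_)
  open import Data.Product using (_×_; _,_)
  open import Data.Nat.Properties
  open import Relation.Binary.PropositionalEquality
  open import Algebra.Properties.CommutativeSemigroup +-commutativeSemigroup using (x∙yz≈y∙xz)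
  open ≡-Reasoning

  high-gap : ∀ M t d → t + d ≤ M → (M ∸ t) ∸ (M ∸ (t + d)) ≡ d
  high-gap M t d t+d≤M = begin
    (M ∸ t) ∸ (M ∸ (t + d)) ≡⟨ cong ((M ∸ t) ∸_) (sym (∸-+-assoc M t d)) ⟩
    (M ∸ t) ∸ ((M ∸ t) ∸ d) ≡⟨ m∸[m∸n]≡n d≤M∸t ⟩
    d                       ∎
    where
    d≤M∸t : d ≤ M ∸ t
    d≤M∸t = subst (_≤ M ∸ t) (m+n∸m≡n t d) (∸-monoˡ-≤ t t+d≤M)

  -- the low label paired with the high label M ∸ t when accounting for M ∸ j
  low-partner : ∀ a j t → t + a ≤ j → a + (j ∸ a ∸ t) ≡ j ∸ t
  low-partner a j t t+a≤j = begin
    a + (j ∸ a ∸ t)   ≡⟨ cong (a +_) (∸-+-assoc j a t) ⟩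
    a + (j ∸ (a + t)) ≡⟨ sym (+-∸-assoc a (subst (_≤ j) (+-comm t a) t+a≤j)) ⟩
    a + j ∸ (a + t)   ≡⟨ [m+n]∸[m+o]≡n∸o a j t ⟩
    j ∸ t             ∎

  low-high-gap : ∀ M a j t → t + a ≤ j → j ≤ M → (M ∸ t) ∸ (a + (j ∸ a ∸ t)) ≡ M ∸ j
  low-high-gap M a j t t+a≤j j≤M = begin
    (M ∸ t) ∸ (a + (j ∸ a ∸ t)) ≡⟨ cong ((M ∸ t) ∸_) (low-partner a j t t+a≤j) ⟩
    (M ∸ t) ∸ (j ∸ t)           ≡⟨ ∸-+-assoc M t (j ∸ t) ⟩
    M ∸ (t + (j ∸ t))           ≡⟨ cong (M ∸_) (m+[n∸m]≡n (≤-trans (m≤m+n t a) t+a≤j)) ⟩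
    M ∸ j                       ∎

  window-coordinates : ∀ a x y M j → a ≤ x → x ≤ y → y ≤ M → j ≤ M → y ∸ x ≡ M ∸ j →
                       (M ∸ y) + a ≤ j × j ∸ a ∸ (M ∸ y) ≡ x ∸ a
  window-coordinates a x y M j a≤x x≤y y≤M j≤M gap≡ =
    subst ((M ∸ y) + a ≤_) (sym j≡) (+-monoʳ-≤ (M ∸ y) a≤x) , (begin
      j ∸ a ∸ (M ∸ y)             ≡⟨ ∸-+-assoc j a (M ∸ y) ⟩
      j ∸ (a + (M ∸ y))           ≡⟨ cong₂ _∸_ j≡ (+-comm a (M ∸ y)) ⟩
      (M ∸ y) + x ∸ ((M ∸ y) + a) ≡⟨ [m+n]∸[m+o]≡n∸o (M ∸ y) x a ⟩
      x ∸ a                       ∎)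
    where
    -- both sides added to M ∸ j give M
    j≡ : j ≡ (M ∸ y) + x
    j≡ = +-cancelˡ-≡ (M ∸ j) j ((M ∸ y) + x) (begin
      (M ∸ j) + j           ≡⟨ m∸n+n≡m j≤M ⟩
      M                     ≡⟨ sym (m∸n+n≡m y≤M) ⟩
      (M ∸ y) + y           ≡⟨ cong ((M ∸ y) +_) (sym (m∸n+n≡m x≤y)) ⟩
      (M ∸ y) + (y ∸ x + x) ≡⟨ cong (λ g → (M ∸ y) + (g + x)) gap≡ ⟩
      (M ∸ y) + (M ∸ j + x) ≡⟨ x∙yz≈y∙xz (M ∸ y) (M ∸ j) x ⟩
      (M ∸ j) + ((M ∸ y) + x) ∎)

  low-partner-injective : ∀ a j t t' → t + a ≤ j → t' + a ≤ j → j ∸ a ∸ t ≡ j ∸ a ∸ t' → t ≡ t'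
  low-partner-injective a j t t' t+a≤j t'+a≤j = ∸-cancelˡ-≡ (below t+a≤j) (below t'+a≤j)
    where
    below : ∀ {s} → s + a ≤ j → s ≤ j ∸ a
    below {s} s+a≤j = subst (_≤ j ∸ a) (m+n∸n≡m s a) (∸-monoˡ-≤ a s+a≤j)

-- Every difference cover passes the window search: for the true position of
-- the non-adjacent pair, the branch guessing the true labels survives every
-- check.  Hence a refuted search rules out all difference covers with the
-- corresponding least label and k.
module SearchSoundness where

  open BooleanChecks
  open WindowSearch
  open WindowArithmetic
  open DifferenceCovers
  open import Data.Bool using (Bool; true; false; _∧_; _∨_; not; _xor_; if_then_else_)
  open import Data.Bool.Properties using (∧-zeroʳ; xor-same)
  open import Data.Nat
  open import Data.Nat.Properties
  open import Data.List using (List; length)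
  open import Data.List.Membership.Propositional using (_∈_)
  open import Data.List.Membership.Propositional.Properties using (∈-++⁺ˡ; ∈-++⁺ʳ)
  open import Data.List.Relation.Unary.Any using (here; there)
  open import Data.Product using (Σ; _×_; _,_; proj₁; proj₂)
  open import Data.Sum using (_⊎_; inj₁; inj₂)
  open import Data.Empty using (⊥; ⊥-elim)
  open import Relation.Nullary using (¬_; yes; no)
  open import Relation.Binary.PropositionalEquality

  module _ {k M : ℕ} (D : DifferenceCover k M) (1≤k : 1 ≤ k) (J : ℕ)
           (least≤J : DifferenceCover.least D ≤ J) (J+k≤M : J + k ≤ M) where
    open DifferenceCover D

    W : ℕ
    W = J ∸ least

    least+W≡J : least + W ≡ J
    least+W≡J = m+[n∸m]≡n least≤J

    J<M : J < M
    J<M = ≤-trans (subst (_≤ J + k) (+-comm J 1) (+-monoʳ-≤ J 1≤k)) J+k≤M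

    lowTruth highTruth : ℕ → Bool
    lowTruth i = label (least + i)
    highTruth t = label (M ∸ t)

    open Faithfulness least lowTruth highTruth

    lowHighSeen lowLowSeen highHighSeen : Bool
    lowHighSeen = (x₀ ∸ least ≤ᵇ W) ∧ (M ∸ y₀ ≤ᵇ J)
    lowLowSeen = y₀ ∸ least ≤ᵇ W
    highHighSeen = M ∸ x₀ ≤ᵇ J

    classify : Bool → Bool → Bool → PairPosition
    classify true _ _ = lowHigh (x₀ ∸ least) (M ∸ y₀)
    classify false true _ = lowLow (x₀ ∸ least) (y₀ ∸ least)
    classify false false true = highHigh (M ∸ y₀) (M ∸ x₀)
    classify false false false = unseen

    position : PairPosition
    position = classify lowHighSeen lowLowSeen highHighSeen

    x₀-low : ∀ {b} → x₀ ∸ least ≡ b → least + b ≡ x₀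
    x₀-low refl = m+[n∸m]≡n (least-min x₀-label)

    y₀-high : ∀ {t} → M ∸ y₀ ≡ t → M ∸ t ≡ y₀
    y₀-high refl = m∸[m∸n]≡n (label≤M y₀-label)

    lowHigh-sound : ∀ c₁ c₂ c₃ {b t} → isLowHigh (classify c₁ c₂ c₃) b t ≡ true →
                    least + b ≡ x₀ × M ∸ t ≡ y₀
    lowHigh-sound true _ _ {b} {t} e =
      let (eb , et) = matches _ _ b t e in x₀-low eb , y₀-high et
    lowHigh-sound false true _ ()
    lowHigh-sound false false true ()
    lowHigh-sound false false false ()

    edge-lowHigh : ∀ {b t} → ¬ (least + b ≡ x₀ × M ∸ t ≡ y₀) → isLowHigh position b t ≡ false
    edge-lowHigh {b} {t} joined with isLowHigh position b t in e
    ... | false = refl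
    ... | true = ⊥-elim (joined (lowHigh-sound lowHighSeen lowLowSeen highHighSeen e))

    lowHigh-complete : ∀ {b t} → b ≤ W → t ≤ J → least + b ≡ x₀ → M ∸ t ≡ y₀ →
                       isLowHigh position b t ≡ true
    lowHigh-complete {b} {t} b≤W t≤J eb et = recognised seen xb yt
      where
      xb : x₀ ∸ least ≡ b
      xb = trans (cong (_∸ least) (sym eb)) (m+n∸m≡n least b)
      yt : M ∸ y₀ ≡ t
      yt = trans (cong (M ∸_) (sym et)) (m∸[m∸n]≡n (≤-trans t≤J (<⇒≤ J<M)))
      seen : lowHighSeen ≡ true
      seen = ∧-intro (≤ᵇ-true (subst (_≤ W) (sym xb) b≤W)) (≤ᵇ-true (subst (_≤ J) (sym yt) t≤J))
      recognised : lowHighSeen ≡ true → x₀ ∸ least ≡ b → M ∸ y₀ ≡ t → isLowHigh position b t ≡ true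
      recognised seen refl refl rewrite seen = matches-refl (x₀ ∸ least) (M ∸ y₀)

    lowHigh-edge : ∀ {b t} → b ≤ W → t ≤ J → isLowHigh position b t ≡ false →
                   ¬ (least + b ≡ x₀ × M ∸ t ≡ y₀)
    lowHigh-edge b≤W t≤J unrecognised (eb , et) =
      false≢true (trans (sym unrecognised) (lowHigh-complete b≤W t≤J eb et))

    position∈positions : position ∈ positions W J
    position∈positions with lowHighSeen in e₁ | lowLowSeen in e₂ | highHighSeen in e₃
    ... | true | _ | _ = let (b≤W , t≤J) = ∧-elim (x₀ ∸ least ≤ᵇ W) e₁ in
      there (∈-++⁺ˡ (∈-grid lowHigh (s≤s (≤ᵇ-sound b≤W)) (s≤s (≤ᵇ-sound t≤J))))
    ... | false | true | _ = there (∈-++⁺ʳ (lowHighPositions W J) (∈-++⁺ˡ (∈-grid lowLow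
           (s≤s (≤-trans (∸-monoˡ-≤ least (<⇒≤ x₀<y₀)) (≤ᵇ-sound e₂))) (s≤s (≤ᵇ-sound e₂)))))
    ... | false | false | true = there (∈-++⁺ʳ (lowHighPositions W J) (∈-++⁺ʳ (lowLowPositions W) (∈-grid highHigh
           (s≤s (≤-trans (∸-monoʳ-≤ M (<⇒≤ x₀<y₀)) (≤ᵇ-sound e₃))) (s≤s (≤ᵇ-sound e₃)))))
    ... | false | false | false = here refl

    -- Inside one window the pair is recognised once the windows are disjoint.
    module Disjoint (J+J<M : J + J < M) where

      J<M∸ : ∀ {t} → t ≤ J → J < M ∸ t
      J<M∸ t≤J = <-≤-trans (subst (_< M ∸ J) (m+n∸n≡m J J) (∸-monoˡ-< J+J<M (m≤n+m J J)))
                           (∸-monoʳ-≤ M t≤J)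

      beyondLow : ∀ {z} → J < z → ¬ (z ∸ least ≤ W)
      beyondLow J<z z∸least≤W = <-irrefl refl (<-≤-trans (∸-monoˡ-< J<z least≤J) z∸least≤W)

      lowLow-complete : ∀ {u v} → v ≤ W → least + u ≡ x₀ → least + v ≡ y₀ →
                        isLowLow position u v ≡ true
      lowLow-complete {u} {v} v≤W eu ev = recognised notLowHigh seen xu yv
        where
        xu : x₀ ∸ least ≡ u
        xu = trans (cong (_∸ least) (sym eu)) (m+n∸m≡n least u)
        yv : y₀ ∸ least ≡ v
        yv = trans (cong (_∸ least) (sym ev)) (m+n∸m≡n least v)
        y₀≤J : y₀ ≤ J
        y₀≤J = subst₂ _≤_ ev least+W≡J (+-monoʳ-≤ least v≤W)
        notLowHigh : lowHighSeen ≡ false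
        notLowHigh = trans (cong ((x₀ ∸ least ≤ᵇ W) ∧_) (≤ᵇ-false (<⇒≱ (J<M∸ y₀≤J)))) (∧-zeroʳ _)
        seen : lowLowSeen ≡ true
        seen = ≤ᵇ-true (subst (_≤ W) (sym yv) v≤W)
        recognised : lowHighSeen ≡ false → lowLowSeen ≡ true → x₀ ∸ least ≡ u → y₀ ∸ least ≡ v →
                     isLowLow position u v ≡ true
        recognised e₁ e₂ refl refl rewrite e₁ | e₂ = matches-refl (x₀ ∸ least) (y₀ ∸ least)

      highHigh-complete : ∀ {u v} → u ≤ v → v ≤ J → M ∸ v ≡ x₀ → M ∸ u ≡ y₀ →
                          isHighHigh position u v ≡ true
      highHigh-complete {u} {v} u≤v v≤J ev eu = recognised notLowHigh notLowLow seen yu xv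
        where
        J<x₀ : J < x₀
        J<x₀ = subst (J <_) ev (J<M∸ v≤J)
        v≤M : v ≤ M
        v≤M = ≤-trans v≤J (<⇒≤ J<M)
        xv : M ∸ x₀ ≡ v
        xv = trans (cong (M ∸_) (sym ev)) (m∸[m∸n]≡n v≤M)
        yu : M ∸ y₀ ≡ u
        yu = trans (cong (M ∸_) (sym eu)) (m∸[m∸n]≡n (≤-trans u≤v v≤M))
        notLowHigh : lowHighSeen ≡ false
        notLowHigh rewrite ≤ᵇ-false (beyondLow J<x₀) = refl
        notLowLow : lowLowSeen ≡ false
        notLowLow = ≤ᵇ-false (beyondLow (<-trans J<x₀ x₀<y₀))
        seen : highHighSeen ≡ true
        seen = ≤ᵇ-true (subst (_≤ J) (sym xv) v≤J)
        recognised : lowHighSeen ≡ false → lowLowSeen ≡ false → highHighSeen ≡ true →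
                     M ∸ y₀ ≡ u → M ∸ x₀ ≡ v → isHighHigh position u v ≡ true
        recognised e₁ e₂ e₃ refl refl rewrite e₁ | e₂ | e₃ = matches-refl (M ∸ y₀) (M ∸ x₀)

      lowLow-edge : ∀ {u v} → v ≤ W → isLowLow position u v ≡ false →
                    ¬ (least + u ≡ x₀ × least + v ≡ y₀)
      lowLow-edge v≤W unrecognised (eu , ev) =
        false≢true (trans (sym unrecognised) (lowLow-complete v≤W eu ev))

      highHigh-edge : ∀ {u v} → u ≤ v → v ≤ J → isHighHigh position u v ≡ false →
                      ¬ (M ∸ v ≡ x₀ × M ∸ u ≡ y₀)
      highHigh-edge u≤v v≤J unrecognised (ev , eu) =
        false≢true (trans (sym unrecognised) (highHigh-complete u≤v v≤J ev eu))

    -- Level j accepts the true bits: M ∸ j is a label or the gap of exactly one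
    -- edge pair, whose ends then lie in the low and the high window.
    module HighValue (L : ℕ) (checkGaps checkOverlap : Bool)
                     (j : ℕ) (j≤J : j ≤ J) (low high : List Bool) (F : Faithful (suc j) low high) where
      open Search least k J L checkGaps checkOverlap position using (accounts; highValueOK)
      open Faithful F

      j<M : j < M
      j<M = <-≤-trans (s≤s j≤J) J<M

      k≤M∸j : k ≤ M ∸ j
      k≤M∸j = subst (_≤ M ∸ j) (m+n∸m≡n j k) (∸-monoˡ-≤ j (≤-trans (+-monoˡ-≤ k j≤J) J+k≤M))

      highBit : ∀ {t} → t ≤ j → bit high t ≡ label (M ∸ t)
      highBit {t} t≤j = high-agrees t (subst (t <_) (sym high-length) (s≤s t≤j))

      module PairOption (t : ℕ) (t+least≤j : t + least ≤ j) where
        b : ℕ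
        b = j ∸ least ∸ t

        t≤j : t ≤ j
        t≤j = ≤-trans (m≤m+n t least) t+least≤j

        b≤W : b ≤ W
        b≤W = ≤-trans (m∸n≤m (j ∸ least) t) (∸-monoˡ-≤ least j≤J)

        lowBit : bit low b ≡ label (least + b)
        lowBit = low-agrees b (subst (b <_) (sym low-length) b<)
          where
          b< : b < suc j ∸ least
          b< = subst (b <_) (sym (+-∸-assoc 1 (≤-trans (m≤n+m least t) t+least≤j)))
                     (s≤s (m∸n≤m (j ∸ least) t))

        gap : (M ∸ t) ∸ (least + b) ≡ M ∸ j
        gap = low-high-gap M least j t t+least≤j (<⇒≤ j<M)

        ordered : least + b < M ∸ t
        ordered = subst (_< M ∸ t) (sym (low-partner least j t t+least≤j)) (∸-monoˡ-< j<M t≤j)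

        unfold : accounts low high j t ≡ label (least + b) ∧ label (M ∸ t) ∧ not (isLowHigh position b t)
        unfold rewrite ≤ᵇ-true t+least≤j | lowBit | highBit t≤j = refl

        edge : accounts low high j t ≡ true → Joined (least + b) (M ∸ t)
        edge accepted with ∧-elim (label (least + b)) (trans (sym unfold) accepted)
        ... | lower , rest with ∧-elim (label (M ∸ t)) rest
        ... | upper , unrecognised =
          edgePair lower upper ordered (lowHigh-edge b≤W (≤-trans t≤j j≤J) (not-true unrecognised))

        accepts : Joined (least + b) (M ∸ t) → accounts low high j t ≡ true
        accepts e = trans unfold (∧-intro lower-label (∧-intro upper-label (cong not (edge-lowHigh joined))))
          where open EdgePair e

        -- an edge gap is not a label, so M ∸ j cannot be accounted for twice
        unlabelled : accounts low high j t ≡ true → ¬ Label (M ∸ j)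
        unlabelled accepted labelled =
          false≢true (trans (sym (gap-unlabelled (edge accepted))) (subst Label (sym gap) labelled))

      labelOption : ∀ t → ¬ (t + least ≤ j) → accounts low high j t ≡ true → t ≡ j × Label (M ∸ j)
      labelOption t t+least≰j accepted rewrite ≤ᵇ-false t+least≰j | highBit (≤-refl {j}) =
        let (t≡ᵇj , labelled) = ∧-elim (t ≡ᵇ j) accepted in ≡ᵇ⇒≡ t j (true⇒T t≡ᵇj) , labelled

      j+least≰j : ¬ (j + least ≤ j)
      j+least≰j = <⇒≱ (m<m+n j (≤-trans 1≤k (k≤label least-label)))

      labelAccepts : Label (M ∸ j) → accounts low high j j ≡ true
      labelAccepts labelled rewrite ≤ᵇ-false j+least≰j | highBit (≤-refl {j}) =
        ∧-intro (T⇒true (≡⇒≡ᵇ j j refl)) labelled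

      -- every number of [k, M] is covered, in particular M ∸ j
      accounted : Σ ℕ λ t → t < suc j × accounts low high j t ≡ true
      accounted with covers (M ∸ j) k≤M∸j (m∸n≤m M j)
      ... | inj₁ labelled = j , ≤-refl , labelAccepts labelled
      ... | inj₂ (x , y , e , gap≡) =
        M ∸ y , s≤s (≤-trans (m≤m+n _ least) (proj₁ coordinates)) ,
        PairOption.accepts (M ∸ y) (proj₁ coordinates) (subst₂ Joined (sym lower≡) (sym upper≡) e)
        where
        open EdgePair e
        coordinates : (M ∸ y) + least ≤ j × j ∸ least ∸ (M ∸ y) ≡ x ∸ least
        coordinates = window-coordinates least x y M j (least-min lower-label) (<⇒≤ ordered)
                                          (label≤M upper-label) (<⇒≤ j<M) gap≡
        lower≡ : least + (j ∸ least ∸ (M ∸ y)) ≡ x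
        lower≡ = trans (cong (least +_) (proj₂ coordinates)) (m+[n∸m]≡n (least-min lower-label))
        upper≡ : M ∸ (M ∸ y) ≡ y
        upper≡ = m∸[m∸n]≡n (label≤M upper-label)

      -- edge gaps are distinct and never labels, so at most one option applies
      accounted-once : ∀ t t' → t < suc j → t' < suc j →
                       accounts low high j t ≡ true → accounts low high j t' ≡ true → t ≡ t'
      accounted-once t t' _ _ e e' with t + least ≤? j | t' + least ≤? j
      ... | yes p | yes p' = low-partner-injective least j t t' p p'
            (+-cancelˡ-≡ least _ _ (gaps-distinct (O.edge e) (O'.edge e') (trans O.gap (sym O'.gap))))
        where
        module O = PairOption t p
        module O' = PairOption t' p'
      ... | yes p | no p' = ⊥-elim (PairOption.unlabelled t p e (proj₂ (labelOption t' p' e')))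
      ... | no p | yes p' = ⊥-elim (PairOption.unlabelled t' p' e' (proj₂ (labelOption t p e)))
      ... | no p | no p' = trans (proj₁ (labelOption t p e)) (sym (proj₁ (labelOption t' p' e')))

      highValue-holds : highValueOK low high j ≡ true
      highValue-holds =
        let (t , t< , accepted) = accounted
        in exactlyOneBelow-intro (accounts low high j) (suc j) t t< accepted accounted-once

    -- With disjoint windows the final check accepts the true bits: two pairs
    -- inside the windows at the same distance d are edges with equal gaps, and
    -- a gap is at least k and never a label.
    module Gaps (J+J<M : J + J < M) (L : ℕ) (checkGaps checkOverlap : Bool)
                (low high : List Bool) (F : Faithful (suc J) low high) where
      open Disjoint J+J<M
      open Search least k J L checkGaps checkOverlap position
        using (gapPair; pairCount; forbiddenGap; gapOK; gapsOK)
      open Faithful F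

      lowBit : ∀ {i} → bit low i ≡ true → i ≤ W × bit low i ≡ label (least + i)
      lowBit {i} set = ≤-pred (subst (i <_) (trans low-length (+-∸-assoc 1 least≤J)) i<)
                     , low-agrees i i<
        where
        i< : i < length low
        i< = bit-in-range low i set

      highBit : ∀ {t} → bit high t ≡ true → t ≤ J × bit high t ≡ label (M ∸ t)
      highBit {t} set = ≤-pred (subst (t <_) high-length t<) , high-agrees t t<
        where
        t< : t < length high
        t< = bit-in-range high t set

      record GapPair (d i : ℕ) : Set where
        field
          lower upper : ℕ
          edge  : Joined lower upper
          gap   : upper ∸ lower ≡ d
          place : (i ≤ W × lower ≡ least + i)
                ⊎ (¬ i ≤ W × lower ≡ M ∸ (i ∸ suc W + d) × i ∸ suc W + d ≤ J)

      lowGapPair : ∀ d i → 1 ≤ d → i ≤ W → gapPair low high d i ≡ true → GapPair d i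
      lowGapPair d i 1≤d i≤W found rewrite ≤ᵇ-true i≤W with ∧-elim (bit low i) found
      ... | set , rest with ∧-elim (bit low (i + d)) rest
      ... | set₂ , unrecognised = record
        { lower = least + i ; upper = least + (i + d)
        ; edge  = edgePair (trans (sym (proj₂ (lowBit set))) set) (trans (sym (proj₂ (lowBit set₂))) set₂)
                           (+-monoʳ-< least (subst (_≤ i + d) (+-comm i 1) (+-monoʳ-≤ i 1≤d)))
                           (lowLow-edge (proj₁ (lowBit set₂)) (not-true unrecognised))
        ; gap   = trans ([m+n]∸[m+o]≡n∸o least (i + d) i) (m+n∸m≡n i d)
        ; place = inj₁ (i≤W , refl) }

      highGapPair : ∀ d i → 1 ≤ d → ¬ i ≤ W → gapPair low high d i ≡ true → GapPair d i
      highGapPair d i 1≤d i≰W found rewrite ≤ᵇ-false i≰W with ∧-elim (bit high (i ∸ suc W)) found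
      ... | set , rest with ∧-elim (bit high (i ∸ suc W + d)) rest
      ... | set₂ , unrecognised = record
        { lower = M ∸ (t + d) ; upper = M ∸ t
        ; edge  = edgePair (trans (sym (proj₂ (highBit set₂))) set₂) (trans (sym (proj₂ (highBit set))) set)
                           (∸-monoʳ-< t<t+d t+d≤M)
                           (highHigh-edge (m≤m+n t d) t+d≤J (not-true unrecognised))
        ; gap   = high-gap M t d t+d≤M
        ; place = inj₂ (i≰W , refl , t+d≤J) }
        where
        t : ℕ
        t = i ∸ suc W
        t+d≤J : t + d ≤ J
        t+d≤J = proj₁ (highBit set₂)
        t+d≤M : t + d ≤ M
        t+d≤M = ≤-trans t+d≤J (<⇒≤ J<M)
        t<t+d : t < t + d
        t<t+d = subst (_≤ t + d) (+-comm t 1) (+-monoʳ-≤ t 1≤d)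

      gapPair-found : ∀ d i → 1 ≤ d → gapPair low high d i ≡ true → GapPair d i
      gapPair-found d i 1≤d found with i ≤? W
      ... | yes i≤W = lowGapPair d i 1≤d i≤W found
      ... | no i≰W = highGapPair d i 1≤d i≰W found

      -- equal gaps force equal lower ends, hence the same position
      gapPair-unique : ∀ {d i i'} → GapPair d i → GapPair d i' → i ≡ i'
      gapPair-unique {d} {i} {i'} p p' =
        samePlace (GapPair.place p) (GapPair.place p')
          (gaps-distinct (GapPair.edge p) (GapPair.edge p') (trans (GapPair.gap p) (sym (GapPair.gap p'))))
        where
        lowBelowJ : ∀ {u} → u ≤ W → least + u ≤ J
        lowBelowJ u≤W = subst (least + _ ≤_) least+W≡J (+-monoʳ-≤ least u≤W)
        highPosition : ∀ {u} → ¬ u ≤ W → u ≡ suc W + (u ∸ suc W)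
        highPosition u≰W = sym (m+[n∸m]≡n (≰⇒> u≰W))
        samePlace : _ → _ → GapPair.lower p ≡ GapPair.lower p' → i ≡ i'
        samePlace (inj₁ (_ , e)) (inj₁ (_ , e')) same =
          +-cancelˡ-≡ least i i' (trans (sym e) (trans same e'))
        samePlace (inj₂ (i≰W , e , t≤J)) (inj₂ (i'≰W , e' , t'≤J)) same =
          trans (highPosition i≰W) (trans (cong (suc W +_) (+-cancelʳ-≡ d _ _
            (∸-cancelˡ-≡ (≤-trans t≤J (<⇒≤ J<M)) (≤-trans t'≤J (<⇒≤ J<M)) (trans (sym e) (trans same e')))))
            (sym (highPosition i'≰W)))
        samePlace (inj₁ (u≤W , e)) (inj₂ (_ , e' , t≤J)) same =
          ⊥-elim (<⇒≱ (J<M∸ t≤J) (subst (_≤ J) (trans (sym e) (trans same e')) (lowBelowJ u≤W)))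
        samePlace (inj₂ (_ , e , t≤J)) (inj₁ (u≤W , e')) same =
          ⊥-elim (<⇒≱ (J<M∸ t≤J) (subst (_≤ J) (trans (sym e') (trans (sym same) e)) (lowBelowJ u≤W)))

      notForbidden : ∀ {d i} → GapPair d i → forbiddenGap low d ≡ true → ⊥
      notForbidden {d} p forbidden with ∨-elim (d <ᵇ k) forbidden
      ... | inj₁ d<k = <⇒≱ (<ᵇ⇒< d k (true⇒T d<k)) (subst (k ≤_) gap (k≤gap edge))
        where open GapPair p
      ... | inj₂ labelledLow with ∧-elim (least ≤ᵇ d) labelledLow
      ... | least≤d , set = false≢true (trans (sym (gap-unlabelled edge)) (subst Label (sym gap) labelled))
        where
        open GapPair p
        labelled : Label d
        labelled = subst Label (m+[n∸m]≡n (≤ᵇ-sound {least} least≤d)) (trans (sym (proj₂ (lowBit set))) set)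

      gapOK-holds : ∀ d → 1 ≤ d → gapOK low high d ≡ true
      gapOK-holds d 1≤d = ∧-intro
        (atMostOneBelow-intro (gapPair low high d) pairCount
          (λ i i' _ _ e e' → gapPair-unique (gapPair-found d i 1≤d e) (gapPair-found d i' 1≤d e')))
        allowed
        where
        absent : forbiddenGap low d ≡ true → ∀ i → i < pairCount → gapPair low high d i ≡ false
        absent forbidden i _ with gapPair low high d i in found
        ... | false = refl
        ... | true = ⊥-elim (notForbidden (gapPair-found d i 1≤d found) forbidden)
        allowed : not (forbiddenGap low d) ∨ noneBelow (gapPair low high d) pairCount ≡ true
        allowed with forbiddenGap low d in forbidden
        ... | false = refl
        ... | true = noneBelow-intro (gapPair low high d) pairCount (absent forbidden)

      gapsOK-holds : gapsOK low high ≡ true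
      gapsOK-holds = allBelow-intro (λ d → gapOK low high (suc d)) J (λ d _ → gapOK-holds (suc d) (s≤s z≤n))

    -- When L = M ∸ least the two windows overlap; the low bit i and the high
    -- bit L ∸ i then describe the same number least + i.
    overlap-holds : ∀ L checkGaps checkOverlap → L ≡ M ∸ least →
                    ∀ j → j ≤ J → ∀ low high → Faithful (suc j) low high →
                    Search.overlapOK least k J L checkGaps checkOverlap position low high ≡ true
    overlap-holds L checkGaps checkOverlap L≡ j j≤J low high F = allBelow-intro _ (length low) sameNumber
      where
      open Faithful F

      i≤W : ∀ {i} → i < length low → i ≤ W
      i≤W {i} i< = ≤-pred (≤-trans (subst (i <_) low-length i<)
                                    (subst (suc j ∸ least ≤_) (+-∸-assoc 1 least≤J) (∸-monoˡ-≤ least (s≤s j≤J))))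

      high≡low : ∀ i → i < length low → M ∸ (L ∸ i) ≡ least + i
      high≡low i i< = begin
        M ∸ (L ∸ i)              ≡⟨ cong (λ l → M ∸ (l ∸ i)) L≡ ⟩
        M ∸ (M ∸ least ∸ i)      ≡⟨ cong (M ∸_) (∸-+-assoc M least i) ⟩
        M ∸ (M ∸ (least + i))    ≡⟨ m∸[m∸n]≡n least+i≤M ⟩
        least + i                ∎
        where
        open ≡-Reasoning
        least+i≤M : least + i ≤ M
        least+i≤M = ≤-trans (subst (least + i ≤_) least+W≡J (+-monoʳ-≤ least (i≤W i<))) (<⇒≤ J<M)

      sameNumber : ∀ i → i < length low →
        (if L ∸ i <ᵇ length high then not (bit low i xor bit high (L ∸ i)) else true) ≡ true
      sameNumber i i< with L ∸ i <ᵇ length high in inHigh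
      ... | false = refl
      ... | true rewrite low-agrees i i< | high-agrees (L ∸ i) (<ᵇ⇒< _ _ (true⇒T inHigh)) | high≡low i i< =
        cong not (xor-same (label (least + i)))

    whenSet : ∀ b {x} → (b ≡ true → x ≡ true) → (if b then x else true) ≡ true
    whenSet true holds = holds refl
    whenSet false _ = refl

    not-refuted : ∀ L checkGaps checkOverlap →
                  (checkGaps ≡ true → J + J < M) → (checkOverlap ≡ true → L ≡ M ∸ least) →
                  refutes least k J L checkGaps checkOverlap ≢ true
    not-refuted L checkGaps checkOverlap gapsHyp overlapHyp refuted =
      false≢true (trans (sym (failsAt-elim least k J L checkGaps checkOverlap refuted position∈positions))
                        (searchAll-complete levels final))
      where
      open Search least k J L checkGaps checkOverlap position
      open Completeness least k J L checkGaps checkOverlap position lowTruth highTruth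

      levels : ∀ j low high → j ≤ J → Faithful (suc j) low high → levelOK j low high ≡ true
      levels j low high j≤J F = ∧-intro
        (HighValue.highValue-holds L checkGaps checkOverlap j j≤J low high F)
        (whenSet checkOverlap (λ set → overlap-holds L checkGaps checkOverlap (overlapHyp set) j j≤J low high F))

      final : ∀ low high → Faithful (suc J) low high → finalOK low high ≡ true
      final low high F = ∧-intro leastBit
        (whenSet checkGaps (λ set → Gaps.gapsOK-holds (gapsHyp set) L checkGaps checkOverlap low high F))
        where
        open Faithful F
        leastBit : bit low 0 ≡ true
        leastBit = trans (low-agrees 0 (subst (0 <_) (sym (trans low-length (+-∸-assoc 1 least≤J))) (s≤s z≤n)))
                         (trans (cong label (+-identityʳ least)) least-label)

-- Depth 7 with gap checks serves every large M; the small
-- cases M = k + 8 (k ≥ 2) and M = 14 (k = 1) are searched through the whole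
-- interval, with depth M ∸ k and the overlap check.
module Computations where

  open WindowSearch using (refutes)
  open import Data.Bool using (true; false)
  open import Data.Nat
  open import Relation.Binary.PropositionalEquality using (_≡_; refl)

  wide-refuted : ∀ a k → 1 ≤ k → k ≤ a → a ≤ 3 → refutes a k 7 0 true false ≡ true
  wide-refuted 1 1 _ _ _ = refl
  wide-refuted 2 1 _ _ _ = refl
  wide-refuted 2 2 _ _ _ = refl
  wide-refuted 3 1 _ _ _ = refl
  wide-refuted 3 2 _ _ _ = refl
  wide-refuted 3 3 _ _ _ = refl
  wide-refuted a 0 () _ _
  wide-refuted 0 (suc k) _ () _
  wide-refuted 1 (suc (suc k)) _ (s≤s ()) _
  wide-refuted 2 (suc (suc (suc k))) _ (s≤s (s≤s ())) _
  wide-refuted 3 (suc (suc (suc (suc k)))) _ (s≤s (s≤s (s≤s ()))) _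
  wide-refuted (suc (suc (suc (suc a)))) _ _ _ (s≤s (s≤s (s≤s ())))

  nine-refuted : ∀ a k → 2 ≤ k → k ≤ a → a ≤ 3 → refutes a k 8 (k + 8 ∸ a) false true ≡ true
  nine-refuted 2 2 _ _ _ = refl
  nine-refuted 3 2 _ _ _ = refl
  nine-refuted 3 3 _ _ _ = refl
  nine-refuted a 0 () _ _
  nine-refuted a 1 (s≤s ()) _ _
  nine-refuted 0 (suc (suc k)) _ () _
  nine-refuted 1 (suc (suc k)) _ (s≤s ()) _
  nine-refuted 2 (suc (suc (suc k))) _ (s≤s (s≤s ())) _
  nine-refuted 3 (suc (suc (suc (suc k)))) _ (s≤s (s≤s (s≤s ()))) _
  nine-refuted (suc (suc (suc (suc a)))) _ _ _ (s≤s (s≤s (s≤s ())))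

  fourteen-refuted : ∀ a → 1 ≤ a → a ≤ 3 → refutes a 1 13 (14 ∸ a) false true ≡ true
  fourteen-refuted 1 _ _ = refl
  fourteen-refuted 2 _ _ = refl
  fourteen-refuted 3 _ _ = refl
  fourteen-refuted 0 () _
  fourteen-refuted (suc (suc (suc (suc a)))) _ (s≤s (s≤s (s≤s ())))

-- K(1,1,2) = K₄ minus an edge is 1-super graceful: the vertices get 1, 9, 4, 7
-- (vertices 2 and 3 are not adjacent) and the edges 01, 02, 03, 12, 13 get
-- 8, 3, 6, 5, 2, the differences of their ends.
module Example where

  open import Defs
  open import Data.Nat using (ℕ; suc; _≤_; _≤?_; ∣_-_∣; _≟_; s≤s)
  open import Data.Nat.Properties using (≤-irrelevant)
  open import Data.Fin using (Fin; zero; suc)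
  import Data.Fin.Properties as FP
  open import Data.Vec using ([]; _∷_; lookup)
  open import Data.Product using (_×_; _,_; proj₁; proj₂)
  open import Data.Sum using (_⊎_; inj₁; inj₂)
  import Data.Sum.Properties as Sum
  open import Relation.Nullary using (Dec)
  open import Relation.Nullary.Decidable using (from-yes; _×-dec_)
  open import Relation.Binary.PropositionalEquality using (_≡_; refl)
  open import Function.Consequences.Propositional
    using (inverseᵇ⇒bijective; strictlyInverseˡ⇒inverseˡ; strictlyInverseʳ⇒inverseʳ)

  G₂ : Graph
  G₂ = K1…12 2

  labelValue : Fin 4 ⊎ Edge G₂ → ℕ
  labelValue (inj₁ v) = lookup (1 ∷ 9 ∷ 4 ∷ 7 ∷ []) v
  labelValue (inj₂ e) = lookup (8 ∷ 3 ∷ 6 ∷ 5 ∷ 2 ∷ []) e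

  inRange : ∀ x → 1 ≤ labelValue x × labelValue x ≤ 9
  inRange (inj₁ v) = from-yes (FP.all? λ v → (1 ≤? labelValue (inj₁ v)) ×-dec (labelValue (inj₁ v) ≤? 9)) v
  inRange (inj₂ e) = from-yes (FP.all? λ e → (1 ≤? labelValue (inj₂ e)) ×-dec (labelValue (inj₂ e) ≤? 9)) e

  labeling : Fin 4 ⊎ Edge G₂ → Interval 1 9
  labeling x = labelValue x , inRange x

  carrier : ℕ → Fin 4 ⊎ Edge G₂
  carrier 1 = inj₁ zero
  carrier 9 = inj₁ (suc zero)
  carrier 4 = inj₁ (suc (suc zero))
  carrier 7 = inj₁ (suc (suc (suc zero)))
  carrier 8 = inj₂ zero
  carrier 3 = inj₂ (suc zero)
  carrier 6 = inj₂ (suc (suc zero))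
  carrier 5 = inj₂ (suc (suc (suc zero)))
  carrier _ = inj₂ (suc (suc (suc (suc zero))))

  _≟ₓ_ : (x y : Fin 4 ⊎ Edge G₂) → Dec (x ≡ y)
  _≟ₓ_ = Sum.≡-dec FP._≟_ FP._≟_

  carrier-labelValue : ∀ x → carrier (labelValue x) ≡ x
  carrier-labelValue (inj₁ v) = from-yes (FP.all? λ v → carrier (labelValue (inj₁ v)) ≟ₓ inj₁ v) v
  carrier-labelValue (inj₂ e) = from-yes (FP.all? λ e → carrier (labelValue (inj₂ e)) ≟ₓ inj₂ e) e

  labeling-carrier : ∀ (n : Interval 1 9) → labeling (carrier (proj₁ n)) ≡ n
  labeling-carrier n = sameNumber (labeling (carrier (proj₁ n))) n (carried n)
    where
    sameNumber : (i j : Interval 1 9) → proj₁ i ≡ proj₁ j → i ≡ j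
    sameNumber (m , 1≤m , m≤9) (.m , 1≤m' , m≤9') refl
      rewrite ≤-irrelevant 1≤m 1≤m' | ≤-irrelevant m≤9 m≤9' = refl
    carried : ∀ (n : Interval 1 9) → labelValue (carrier (proj₁ n)) ≡ proj₁ n
    carried (1 , _) = refl
    carried (2 , _) = refl
    carried (3 , _) = refl
    carried (4 , _) = refl
    carried (5 , _) = refl
    carried (6 , _) = refl
    carried (7 , _) = refl
    carried (8 , _) = refl
    carried (9 , _) = refl
    carried (0 , () , _)
    carried (suc (suc (suc (suc (suc (suc (suc (suc (suc (suc _))))))))) ,
             _ , s≤s (s≤s (s≤s (s≤s (s≤s (s≤s (s≤s (s≤s (s≤s ())))))))))

  unlabel : Interval 1 9 → Fin 4 ⊎ Edge G₂
  unlabel n = carrier (proj₁ n)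

  K112-1-superGraceful : IsKSuperGraceful 1 G₂
  K112-1-superGraceful = record
    { f = labeling
    ; bij = inverseᵇ⇒bijective (strictlyInverseˡ⇒inverseˡ {f⁻¹ = unlabel} labeling labeling-carrier
                              , strictlyInverseʳ⇒inverseʳ {f⁻¹ = unlabel} labeling carrier-labelValue)
    ; edge-lab = from-yes (FP.all? λ e →
        labelValue (inj₂ e) ≟ ∣ labelValue (inj₁ (proj₁ (ends G₂ e))) - labelValue (inj₁ (proj₂ (ends G₂ e))) ∣)
    }

open import Defs
open DifferenceCovers
open Computations
open SearchSoundness using (not-refuted)
open Labelings using (module ToCover)
open EdgeCount using (ten≤edges)
open Example using (K112-1-superGraceful)
open import Data.Bool using (true; false)
open import Data.Nat
open import Data.Nat.Properties
open import Data.Product using (_×_; _,_)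
open import Data.Empty using (⊥; ⊥-elim)
open import Function.Bundles using (_⇔_; mk⇔)
open import Relation.Binary.PropositionalEquality

module _ {k X : ℕ} (D : DifferenceCover k (k + X)) (1≤k : 1 ≤ k) where
  open DifferenceCover D

  least-small : 3 ≤ X → least ≤ 3
  least-small 3≤X = least≤3 D (+-monoʳ-≤ k 3≤X)

  noWideCover : 7 ≤ X → 14 < k + X → ⊥
  noWideCover 7≤X 14<k+X =
    not-refuted D 1≤k 7 (≤-trans a≤3 (m≤m+n 3 4)) 7+k≤k+X 0 true false (λ _ → 14<k+X) (λ ())
                (wide-refuted least k 1≤k (k≤label least-label) a≤3)
    where
    a≤3 : least ≤ 3
    a≤3 = least-small (≤-trans (m≤m+n 3 4) 7≤X)
    7+k≤k+X : 7 + k ≤ k + X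
    7+k≤k+X = subst (_≤ k + X) (+-comm k 7) (+-monoʳ-≤ k 7≤X)

  noNineCover : X ≡ 8 → 2 ≤ k → ⊥
  noNineCover refl 2≤k =
    not-refuted D 1≤k 8 (≤-trans a≤3 (m≤m+n 3 5)) (≤-reflexive (+-comm 8 k)) (k + 8 ∸ least)
                false true (λ ()) (λ _ → refl) (nine-refuted least k 2≤k (k≤label least-label) a≤3)
    where
    a≤3 : least ≤ 3
    a≤3 = least-small (m≤m+n 3 5)

  noFourteenCover : k ≡ 1 → X ≡ 13 → ⊥
  noFourteenCover refl refl =
    not-refuted D 1≤k 13 (≤-trans a≤3 (m≤m+n 3 10)) ≤-refl (14 ∸ least) false true (λ ()) (λ _ → refl)
                (fourteen-refuted least (≤-trans 1≤k (k≤label least-label)) a≤3)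
    where
    a≤3 : least ≤ 3
    a≤3 = least-small (m≤m+n 3 10)

largest≡ : ∀ k G → 1 ≤ p G → k + p G + q G ∸ 1 ≡ k + (p G + q G ∸ 1)
largest≡ k G 1≤p =
  trans (cong (_∸ 1) (+-assoc k (p G) (q G))) (+-∸-assoc k (≤-trans 1≤p (m≤m+n (p G) (q G))))

coverOf : ∀ r k → SuperGracefulLabeling k (K1…12 r) → DifferenceCover k (k + (r + 2 + q (K1…12 r) ∸ 1))
coverOf r k L =
  subst (DifferenceCover k) (largest≡ k (K1…12 r) (≤-trans (s≤s z≤n) (m≤n+m 2 r))) (ToCover.cover r k L)

-- for r ≥ 4 there are at least ten edges, so [k, M] has at least 16 elements
fifteen≤ : ∀ r → 4 ≤ r → 15 ≤ r + 2 + q (K1…12 r) ∸ 1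
fifteen≤ r 4≤r = ∸-monoˡ-≤ 1 (+-mono-≤ (+-monoˡ-≤ 2 4≤r) (ten≤edges r 4≤r))

onlyK112 : ∀ r k → r ≥ 2 → k ≥ 1 → IsKSuperGraceful k (K1…12 r) → r ≡ 2 × k ≡ 1
onlyK112 2 1 _ _ _ = refl , refl
onlyK112 2 (suc (suc k)) _ 1≤k L = ⊥-elim (noNineCover (coverOf 2 _ L) 1≤k refl (s≤s (s≤s z≤n)))
onlyK112 3 1 _ 1≤k L = ⊥-elim (noFourteenCover (coverOf 3 1 L) 1≤k refl refl)
onlyK112 3 (suc (suc k)) _ 1≤k L =
  ⊥-elim (noWideCover (coverOf 3 _ L) 1≤k (m≤m+n 7 6) (+-monoˡ-≤ 13 (s≤s (s≤s z≤n))))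
onlyK112 r@(suc (suc (suc (suc _)))) k _ 1≤k L =
  ⊥-elim (noWideCover (coverOf r k L) 1≤k (≤-trans (m≤m+n 7 8) 15≤X) (≤-trans 15≤X (m≤n+m _ k)))
  where
  15≤X : 15 ≤ r + 2 + q (K1…12 r) ∸ 1
  15≤X = fifteen≤ r (s≤s (s≤s (s≤s (s≤s z≤n))))
onlyK112 0 k () _ _
onlyK112 1 k (s≤s ()) _ _

theorem4p8 : (r k : ℕ) → r ≥ 2 → k ≥ 1 →
    IsKSuperGraceful k (K1…12 r) ⇔ (r ≡ 2 × k ≡ 1)
theorem4p8 r k r≥2 k≥1 = mk⇔ (onlyK112 r k r≥2 k≥1) (λ { (refl , refl) → K112-1-superGraceful })
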